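{- Let $1\leqslant k<n$ be integers and $\mathbb{Z}\Delta=\{x\in\mathbb{Z}^n : k\mid x_1+\cdots+x_n\}$, with quadratic form $q(x)=\sum_{i=1}^n x_i^2+\frac{2-k}{k^2}\big(\sum_{i=1}^n x_i\big)^2$. Then the group $W(\mathsf{J}_{k,n})$ generated by $s_\beta,s_1,\ldots,s_{n-1}$ acts on $\mathbb{Z}\Delta$ by isometries: $q(wx)=q(x)$ for all $w\in W(\mathsf{J}_{k,n})$ and $x\in\mathbb{Z}\Delta$.
   Context: For $x\in\mathbb{Z}\Delta$, $\deg(x)=(x_1+\cdots+x_n)/k$. For $i=1,\ldots,n-1$, $s_i$ swaps the $i$-th and $(i+1)$-st coordinates. $s_\beta(x)=(x_1+r,\ldots,x_k+r,x_{k+1},\ldots,x_n)^\top$ with $r=x_{k+1}+\cdots+x_n-2\deg(x)$. -}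

module Defs where

open import Data.Nat as ℕ using (ℕ; zero; suc)
open import Data.Nat.Properties using (_≟_; _<?_)
open import Data.Fin as Fin using (Fin; toℕ)
open import Data.Integer using (ℤ; +_; _+_; _-_; _*_)
open import Data.Integer.DivMod using (_/ℕ_)
open import Data.Integer.Divisibility using (_∣_)
open import Data.Vec.Functional using (Vector; foldr)
open import Relation.Nullary.Decidable using (does)
open import Data.Bool using (if_then_else_)
open import Relation.Binary.PropositionalEquality using (_≡_)
open import Data.Product using (_×_)

-- integer vectors x ∈ ℤ^n, coordinates indexed by Fin n (coordinate i+1 of the paper = index i)
ℤVec : ℕ → Set
ℤVec n = Vector ℤ n

Σx : ∀ {n} → ℤVec n → ℤ
Σx = foldr _+_ (+ 0)

InℤΔ : (k n : ℕ) → ℤVec n → Set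
InℤΔ k n x = (+ k) ∣ Σx x

-- deg(x) = (x₁+⋯+xₙ)/k  (exact on ℤΔ; k ≥ 1 in the theorem, the k = 0 clause is a dummy)
deg : (k : ℕ) → ∀ {n} → ℤVec n → ℤ
deg zero    x = + 0
deg (suc k) x = Σx x /ℕ suc k

-- q(x) = Σ xᵢ² + ((2-k)/k²)(Σ xᵢ)²  =  Σ xᵢ² + (2-k)·deg(x)²   (for x ∈ ℤΔ)
q : (k : ℕ) → ∀ {n} → ℤVec n → ℤ
q k x = foldr (λ a b → a * a + b) (+ 0) x + ((+ 2) - (+ k)) * (deg k x * deg k x)

-- s_i (0-based index i, swaps coordinates i and i+1; the paper's s_{i+1})
sᵢ : ∀ {n} → ℕ → ℤVec n → ℤVec n
sᵢ i x j =
  if does (toℕ j ≟ i) then x' (suc i)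
  else if does (toℕ j ≟ suc i) then x' i
  else x j
  where
  x' : ℕ → ℤ
  x' m = lookupℕ x m
    where
    lookupℕ : ∀ {n} → ℤVec n → ℕ → ℤ
    lookupℕ {zero}  y m       = + 0
    lookupℕ {suc n} y zero    = y Fin.zero
    lookupℕ {suc n} y (suc m) = lookupℕ (λ t → y (Fin.suc t)) m

sβ : (k : ℕ) → ∀ {n} → ℤVec n → ℤVec n
sβ k x j = if does (toℕ j <? k) then x j + r else x j
  where
  tailSum : ℤ
  tailSum = foldr _+_ (+ 0) (λ j → if does (toℕ j <? k) then + 0 else x j)
  r : ℤ
  r = tailSum - (+ 2) * deg k x

data InW (k n : ℕ) : (ℤVec n → ℤVec n) → Set where
  genβ : InW k n (sβ k)
  genᵢ : (i : ℕ) → suc i ℕ.< n → InW k n (sᵢ i)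
  idW  : InW k n (λ x → x)
  comp : ∀ {f g} → InW k n f → InW k n g → InW k n (λ x → f (g x))
  inv  : ∀ {f g} → InW k n f →
         (∀ x → InℤΔ k n x → InℤΔ k n (g x) × f (g x) ≡ x × g (f x) ≡ x) →
         InW k n g

-- Each generator preserves both ℤΔ and q, and these two properties are closed under
-- composition and inverses. The swaps sᵢ permute coordinates, so they fix Σ xᵢ and Σ xᵢ².
-- For s_β write d = deg x, t = x_{k+1} + ⋯ + xₙ and h = x₁ + ⋯ + x_k = dk − t. Adding
-- r = t − 2d to the first k coordinates changes the sum by kr, so s_β x ∈ ℤΔ with degree
-- t − d, and changes Σ xᵢ² by 2rh + kr²; substituting h, the change of q is a polynomial
-- identity in d, k, t.
module Submission where

open import Defs
open import Data.Nat using (ℕ; zero; suc; _≤_; _<_; s≤s)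
open import Data.Nat.Properties using (_<?_; <⇒≤)
import Data.Nat.DivMod as ℕ
open import Data.Fin as Fin using (toℕ)
open import Data.Integer using (ℤ; +_; -[1+_]; _+_; _-_; _*_; _/ℕ_)
import Data.Integer.Properties as ℤ
open import Data.Integer.Divisibility using (_∣_)
open import Data.Integer.Divisibility.Signed using (divides; ∣ᵤ⇒∣; ∣⇒∣ᵤ)
open import Data.Integer.Tactic.RingSolver using (solve-∀)
open import Data.Vec.Functional using (foldr; tail)
open import Data.Bool using (true; false; if_then_else_)
open import Data.Product using (_×_; _,_; proj₂)
open import Relation.Nullary.Decidable using (does)
open import Relation.Binary.PropositionalEquality
  using (_≡_; refl; sym; trans; cong; cong₂; subst; module ≡-Reasoning)

open ≡-Reasoning

IsIsometry : (k n : ℕ) → (ℤVec n → ℤVec n) → Set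
IsIsometry k n w = ∀ x → InℤΔ k n x → InℤΔ k n (w x) × q k (w x) ≡ q k x

id-isIsometry : ∀ {k n} → IsIsometry k n (λ x → x)
id-isIsometry x x∈ℤΔ = x∈ℤΔ , refl

∘-isIsometry : ∀ {k n f g} → IsIsometry k n f → IsIsometry k n g →
               IsIsometry k n (λ x → f (g x))
∘-isIsometry f-iso g-iso x x∈ℤΔ with g-iso x x∈ℤΔ
... | gx∈ℤΔ , qg with f-iso _ gx∈ℤΔ
... | fgx∈ℤΔ , qf = fgx∈ℤΔ , trans qf qg

rightInverse-isIsometry : ∀ {k n f g} → IsIsometry k n f →
  (∀ x → InℤΔ k n x → InℤΔ k n (g x) × f (g x) ≡ x) → IsIsometry k n g
rightInverse-isIsometry {k} f-iso g-inv x x∈ℤΔ with g-inv x x∈ℤΔ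
... | gx∈ℤΔ , fgx≡x = gx∈ℤΔ , trans (sym (proj₂ (f-iso _ gx∈ℤΔ))) (cong (q k) fgx≡x)

sumOf : (ℤ → ℤ) → ∀ {n} → ℤVec n → ℤ
sumOf g = foldr (λ a b → g a + b) (+ 0)

sumOfSquares : ∀ {n} → ℤVec n → ℤ
sumOfSquares = sumOf (λ a → a * a)

sumOf-cong : ∀ g {n} {x y : ℤVec n} → (∀ j → x j ≡ y j) → sumOf g x ≡ sumOf g y
sumOf-cong g {zero}  x≗y = refl
sumOf-cong g {suc n} x≗y = cong₂ (λ a b → g a + b) (x≗y Fin.zero) (sumOf-cong g (λ j → x≗y (Fin.suc j)))

sumOf-sᵢ : ∀ g {n} i (x : ℤVec n) → suc i < n → sumOf g (sᵢ i x) ≡ sumOf g x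
sumOf-sᵢ g {suc (suc n)} zero x _ =
  swap (g (x (Fin.suc Fin.zero))) (g (x Fin.zero)) (sumOf g (λ j → x (Fin.suc (Fin.suc j))))
  where
  swap : ∀ a b c → a + (b + c) ≡ b + (a + c)
  swap = solve-∀
sumOf-sᵢ g {suc n} (suc i) x (s≤s i+1<n) = cong (λ s → g (x Fin.zero) + s) (sumOf-sᵢ g i (tail x) i+1<n)

Σx-+ : ∀ {n} (u v : ℤVec n) → Σx (λ j → u j + v j) ≡ Σx u + Σx v
Σx-+ {zero}  u v = refl
Σx-+ {suc n} u v = begin
  u₀ + v₀ + Σx (λ j → tail u j + tail v j) ≡⟨ cong (λ s → u₀ + v₀ + s) (Σx-+ (tail u) (tail v)) ⟩
  u₀ + v₀ + (Σx (tail u) + Σx (tail v))    ≡⟨ interchange u₀ v₀ (Σx (tail u)) (Σx (tail v)) ⟩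
  u₀ + Σx (tail u) + (v₀ + Σx (tail v))    ∎
  where
  u₀ = u Fin.zero
  v₀ = v Fin.zero
  interchange : ∀ a b c d → a + b + (c + d) ≡ a + c + (b + d)
  interchange = solve-∀

i*n/ℕn≡i : ∀ i n → (i * + suc n) /ℕ suc n ≡ i
i*n/ℕn≡i (+ m)    n = trans (cong (_/ℕ suc n) (sym (ℤ.pos-* m (suc n)))) (cong +_ (ℕ.m*n/n≡m m (suc n)))
i*n/ℕn≡i -[1+ m ] n rewrite ℕ.m*n%n≡0 (suc m) (suc n) {{_}} | ℕ.m*n/n≡m (suc m) (suc n) {{_}} = refl

Σx≡deg*k : ∀ k {n} (x : ℤVec n) → InℤΔ (suc k) n x → Σx x ≡ deg (suc k) x * + suc k
Σx≡deg*k k x x∈ℤΔ with ∣ᵤ⇒∣ x∈ℤΔ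
... | divides c Σx≡c*k = trans Σx≡c*k (cong (_* + suc k) (sym (trans (cong (_/ℕ suc k) Σx≡c*k) (i*n/ℕn≡i c k))))

deg-cong : ∀ k {n} {x y : ℤVec n} → Σx x ≡ Σx y → deg k x ≡ deg k y
deg-cong zero    Σx≡Σy = refl
deg-cong (suc k) Σx≡Σy = cong (_/ℕ suc k) Σx≡Σy

sumAndSquares-isIsometry : ∀ k {n} (w : ℤVec n → ℤVec n) →
  (∀ x → Σx (w x) ≡ Σx x) → (∀ x → sumOfSquares (w x) ≡ sumOfSquares x) → IsIsometry k n w
sumAndSquares-isIsometry k w Σ-inv squares-inv x x∈ℤΔ =
  subst (+ k ∣_) (sym (Σ-inv x)) x∈ℤΔ ,
  cong₂ (λ s d → s + (+ 2 - + k) * (d * d)) (squares-inv x) (deg-cong k (Σ-inv x))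

sᵢ-isIsometry : ∀ k {n} i → suc i < n → IsIsometry k n (sᵢ i)
sᵢ-isIsometry k i i+1<n =
  sumAndSquares-isIsometry k (sᵢ i) (λ x → sumOf-sᵢ (λ a → a) i x i+1<n) (λ x → sumOf-sᵢ (λ a → a * a) i x i+1<n)

takeHead dropHead : ℕ → ∀ {n} → ℤVec n → ℤVec n
takeHead k x j = if does (toℕ j <? k) then x j else + 0
dropHead k x j = if does (toℕ j <? k) then + 0 else x j

headSum tailSum : ℕ → ∀ {n} → ℤVec n → ℤ
headSum k x = Σx (takeHead k x)
tailSum k x = Σx (dropHead k x)

-- sβ k x unfolds to shiftHead k (tailSum k x - + 2 * deg k x) x.
shiftHead : ℕ → ℤ → ∀ {n} → ℤVec n → ℤVec n
shiftHead k r x j = if does (toℕ j <? k) then x j + r else x j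

Σx≡headSum+tailSum : ∀ k {n} (x : ℤVec n) → Σx x ≡ headSum k x + tailSum k x
Σx≡headSum+tailSum k {n} x = trans (sumOf-cong (λ a → a) {n} split) (Σx-+ (takeHead k x) (dropHead k x))
  where
  split : ∀ j → x j ≡ takeHead k x j + dropHead k x j
  split j with does (toℕ j <? k)
  ... | true  = sym (ℤ.+-identityʳ (x j))
  ... | false = sym (ℤ.+-identityˡ (x j))

headSum-zero : ∀ {n} (x : ℤVec n) → headSum 0 x ≡ + 0
headSum-zero {zero}  x = refl
headSum-zero {suc n} x = trans (ℤ.+-identityˡ _) (headSum-zero (tail x))

Σx-shiftHead : ∀ k r {n} (x : ℤVec n) → k ≤ n → Σx (shiftHead k r x) ≡ Σx x + + k * r
Σx-shiftHead zero    r {n} x _ = trans (sumOf-cong (λ a → a) {n} (λ j → refl)) (no-shift (Σx x) r)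
  where
  no-shift : ∀ s r → s ≡ s + + 0 * r
  no-shift = solve-∀
Σx-shiftHead (suc k) r x (s≤s k≤n) =
  trans (cong (λ s → x Fin.zero + r + s) (Σx-shiftHead k r (tail x) k≤n))
        (regroup (x Fin.zero) (Σx (tail x)) (+ k) r)
  where
  regroup : ∀ a s k r → a + r + (s + k * r) ≡ a + s + (+ 1 + k) * r
  regroup = solve-∀

sumOfSquares-shiftHead : ∀ k r {n} (x : ℤVec n) → k ≤ n →
  sumOfSquares (shiftHead k r x) ≡ sumOfSquares x + + 2 * r * headSum k x + + k * (r * r)
sumOfSquares-shiftHead zero r {n} x _ = begin
  sumOfSquares (shiftHead 0 r x)                       ≡⟨ sumOf-cong (λ a → a * a) {n} (λ j → refl) ⟩
  sumOfSquares x                                       ≡⟨ no-shift (sumOfSquares x) r ⟩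
  sumOfSquares x + + 2 * r * + 0 + + 0 * (r * r)       ≡⟨ cong (λ h → sumOfSquares x + + 2 * r * h + + 0 * (r * r)) (sym (headSum-zero x)) ⟩
  sumOfSquares x + + 2 * r * headSum 0 x + + 0 * (r * r) ∎
  where
  no-shift : ∀ s r → s ≡ s + + 2 * r * + 0 + + 0 * (r * r)
  no-shift = solve-∀
sumOfSquares-shiftHead (suc k) r x (s≤s k≤n) =
  trans (cong (λ s → (x Fin.zero + r) * (x Fin.zero + r) + s) (sumOfSquares-shiftHead k r (tail x) k≤n))
        (regroup (x Fin.zero) (sumOfSquares (tail x)) (headSum k (tail x)) (+ k) r)
  where
  regroup : ∀ a s h k r → (a + r) * (a + r) + (s + + 2 * r * h + k * (r * r))
                        ≡ a * a + s + + 2 * r * (a + h) + (+ 1 + k) * (r * r)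
  regroup = solve-∀

sβ-isIsometry : ∀ k {n} → suc k ≤ n → IsIsometry (suc k) n (sβ (suc k))
sβ-isIsometry k 1+k≤n x x∈ℤΔ = ∣⇒∣ᵤ (divides (t - d) Σx-sβ) , q-sβ
  where
  K d t r : ℤ
  K = + suc k
  d = deg (suc k) x
  t = tailSum (suc k) x
  r = t - + 2 * d

  Σx≡d*K : Σx x ≡ d * K
  Σx≡d*K = Σx≡deg*k k x x∈ℤΔ

  headSum≡d*K-t : headSum (suc k) x ≡ d * K - t
  headSum≡d*K-t = begin
    headSum (suc k) x            ≡⟨ add-sub (headSum (suc k) x) t ⟩
    headSum (suc k) x + t - t    ≡⟨ cong (_- t) (trans (sym (Σx≡headSum+tailSum (suc k) x)) Σx≡d*K) ⟩
    d * K - t                    ∎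
    where
    add-sub : ∀ h t → h ≡ h + t - t
    add-sub = solve-∀

  Σx-sβ : Σx (sβ (suc k) x) ≡ (t - d) * K
  Σx-sβ = begin
    Σx (sβ (suc k) x)   ≡⟨ Σx-shiftHead (suc k) r x 1+k≤n ⟩
    Σx x + K * r        ≡⟨ cong (_+ K * r) Σx≡d*K ⟩
    d * K + K * r       ≡⟨ identity d K t ⟩
    (t - d) * K         ∎
    where
    identity : ∀ d K t → d * K + K * (t - + 2 * d) ≡ (t - d) * K
    identity = solve-∀

  deg-sβ : deg (suc k) (sβ (suc k) x) ≡ t - d
  deg-sβ = trans (cong (_/ℕ suc k) Σx-sβ) (i*n/ℕn≡i (t - d) k)

  q-sβ : q (suc k) (sβ (suc k) x) ≡ q (suc k) x
  q-sβ = begin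
    q (suc k) (sβ (suc k) x)
      ≡⟨ cong₂ (λ s e → s + (+ 2 - K) * (e * e)) (sumOfSquares-shiftHead (suc k) r x 1+k≤n) deg-sβ ⟩
    sumOfSquares x + + 2 * r * headSum (suc k) x + K * (r * r) + (+ 2 - K) * ((t - d) * (t - d))
      ≡⟨ cong (λ h → sumOfSquares x + + 2 * r * h + K * (r * r) + (+ 2 - K) * ((t - d) * (t - d))) headSum≡d*K-t ⟩
    sumOfSquares x + + 2 * r * (d * K - t) + K * (r * r) + (+ 2 - K) * ((t - d) * (t - d))
      ≡⟨ identity (sumOfSquares x) d K t ⟩
    q (suc k) x
      ∎
    where
    identity : ∀ s d K t →
      s + + 2 * (t - + 2 * d) * (d * K - t) + K * ((t - + 2 * d) * (t - + 2 * d)) + (+ 2 - K) * ((t - d) * (t - d))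
      ≡ s + (+ 2 - K) * (d * d)
    identity = solve-∀

lemma2p2 : (k n : ℕ) → 1 ≤ k → k < n →
    (w : ℤVec n → ℤVec n) → InW k n w →
    (x : ℤVec n) → InℤΔ k n x → InℤΔ k n (w x) × q k (w x) ≡ q k x
lemma2p2 (suc k) n _ k<n w w∈W = isIsometry w∈W
  where
  isIsometry : ∀ {w} → InW (suc k) n w → IsIsometry (suc k) n w
  isIsometry genβ              = sβ-isIsometry k (<⇒≤ k<n)
  isIsometry (genᵢ i i+1<n)    = sᵢ-isIsometry (suc k) i i+1<n
  isIsometry idW               = id-isIsometry
  isIsometry (comp w∈W v∈W)    = ∘-isIsometry (isIsometry w∈W) (isIsometry v∈W)
  isIsometry (inv w∈W inverse) =
    rightInverse-isIsometry (isIsometry w∈W) (λ x x∈ℤΔ → let (gx∈ℤΔ , fgx≡x , _) = inverse x x∈ℤΔ in gx∈ℤΔ , fgx≡x)
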